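{- Let $s\in\mathbb{N}$, let $P\in\mathbb{Z}[X]$ have positive degree, let $a_1,\ldots,a_s$ be non-zero integers and let $b\in\mathbb{Z}$. If the equation $a_1P(x_1)+\cdots+a_sP(x_s)=b$ is partition regular, then $b=(a_1+\cdots+a_s)m$ for some $m\in\mathbb{Z}$ such that $P(X)-m$ is an intersective polynomial. Furthermore, if this equation is density regular, then $b=a_1+\cdots+a_s=0$.
   Context: A polynomial $Q\in\mathbb{Z}[X]$ is intersective if for every positive integer $n$ there exists an integer $x$ with $n\mid Q(x)$. A solution $(x_1,\ldots,x_s)$ is non-constant if $x_i\neq x_j$ for some $i\neq j$. An equation is partition regular if for every finite colouring of the positive integers there is a monochromatic non-constant solution. It is density regular if every set $A\subseteq\mathbb{N}$ with $\limsup_{N\to\infty}|A\cap\{1,\ldots,N\}|/N>0$ contains a non-constant solution (all $x_i\in A$). -}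

module Defs where

open import Data.Nat as ℕ using (ℕ; zero; suc)
open import Data.Integer as ℤ using (ℤ; +_; 0ℤ)
open import Data.Integer.Divisibility using (_∣_)
open import Data.Fin using (Fin; zero; suc)
open import Data.List using (List; []; _∷_)
open import Data.Bool using (Bool; true; false)
open import Data.Product using (Σ; ∃; _×_; _,_)
open import Relation.Binary.PropositionalEquality using (_≡_; _≢_)

-- Polynomials in ℤ[X] as coefficient lists, constant term first:
-- c₀ ∷ c₁ ∷ … represents c₀ + c₁ X + c₂ X² + …
Poly : Set
Poly = List ℤ

eval : Poly → ℤ → ℤ
eval []       x = 0ℤ
eval (c ∷ cs) x = c ℤ.+ x ℤ.* eval cs x

coeff : Poly → ℕ → ℤ
coeff []       _       = 0ℤ
coeff (c ∷ cs) zero    = c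
coeff (c ∷ cs) (suc i) = coeff cs i

PositiveDegree : Poly → Set
PositiveDegree P = ∃ λ i → coeff P (suc i) ≢ 0ℤ

subConst : Poly → ℤ → Poly
subConst []       m = ℤ.- m ∷ []
subConst (c ∷ cs) m = (c ℤ.- m) ∷ cs

Intersective : Poly → Set
Intersective Q = (n : ℕ) → 1 ℕ.≤ n → ∃ λ (x : ℤ) → (+ n) ∣ eval Q x

sumFin : (s : ℕ) → (Fin s → ℤ) → ℤ
sumFin zero    f = 0ℤ
sumFin (suc s) f = f zero ℤ.+ sumFin s (λ i → f (suc i))

IsSolution : (s : ℕ) → Poly → (Fin s → ℤ) → ℤ → (Fin s → ℕ) → Set
IsSolution s P a b x =
  ((i : Fin s) → 1 ℕ.≤ x i) × sumFin s (λ i → a i ℤ.* eval P (+ (x i))) ≡ b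

NonConstant : (s : ℕ) → (Fin s → ℕ) → Set
NonConstant s x = Σ (Fin s) λ i → Σ (Fin s) λ j → x i ≢ x j

-- partition regular: every finite colouring of the positive integers
-- (a colouring c : ℕ → Fin r, only its values on positive integers matter)
-- admits a monochromatic non-constant solution
PartitionRegular : (s : ℕ) → Poly → (Fin s → ℤ) → ℤ → Set
PartitionRegular s P a b =
  (r : ℕ) (c : ℕ → Fin r) →
  ∃ λ (x : Fin s → ℕ) → IsSolution s P a b x × NonConstant s x ×
    ((i j : Fin s) → c (x i) ≡ c (x j))

count : (ℕ → Bool) → ℕ → ℕ
count A zero    = zero
count A (suc N) with A (suc N)
... | true  = suc (count A N)
... | false = count A N

-- positive upper density: limsup |A ∩ [1,N]|/N > 0, i.e. there is k ≥ 1 with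
-- |A ∩ [1,N]|/N ≥ 1/k for infinitely many N
PositiveUpperDensity : (ℕ → Bool) → Set
PositiveUpperDensity A =
  ∃ λ k → 1 ℕ.≤ k × ((M : ℕ) → ∃ λ N → M ℕ.≤ N × 1 ℕ.≤ N × N ℕ.≤ k ℕ.* count A N)

DensityRegular : (s : ℕ) → Poly → (Fin s → ℤ) → ℤ → Set
DensityRegular s P a b =
  (A : ℕ → Bool) → PositiveUpperDensity A →
  ∃ λ (x : Fin s → ℕ) → IsSolution s P a b x × NonConstant s x ×
    ((i : Fin s) → A (x i) ≡ true)

{-# OPTIONS --safe #-}
-- If xᵢ ≡ t (mod n) for all i, a solution gives b ≡ (a₁+⋯+aₛ) P(t) (mod n).
-- Colouring the positive integers by their residue mod n, a monochromatic
-- solution produces such a t for every n; taking n a multiple of A = a₁+⋯+aₛ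
-- shows A ∣ b, say b = A m, and then P(t) ≡ m (mod n), so P − m is intersective.
-- Every residue class mod n has positive upper density, so under density
-- regularity b ≡ A P(t) modulo every n, i.e. b = A P(t) for every t ∈ ℕ.  As P
-- is not constant on ℕ this forces A = 0, and then b = 0.
module Submission where

open import Defs
open import Data.Nat using (ℕ)
open import Data.Integer using (ℤ; _*_; 0ℤ)
open import Data.Fin using (Fin)
open import Data.Product using (∃; _×_)
open import Relation.Binary.PropositionalEquality using (_≡_; _≢_)

open import Data.Bool using (Bool; true; false)
open import Data.Bool.Properties using (T-≡)
open import Data.Empty using (⊥-elim)
open import Data.Fin using (zero; suc; fromℕ<)
open import Data.Fin.Properties using (fromℕ<-injective)
open import Data.Integer using (+_; _+_; _-_; -_; ∣_∣; NonZero; ≢-nonZero; _%ℕ_; _/ℕ_)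
import Data.Integer.Divisibility as Unsigned
open import Data.Integer.DivMod using (n%ℕd<d; a≡a%ℕn+[a/ℕn]*n)
open import Data.Integer.Divisibility.Signed
  using (_∣_; divides; _∣?_; ∣-refl; ∣-trans; ∣⇒∣ᵤ; m∣∣m∣; ∣m∣n⇒∣m+n; ∣m⇒∣-m;
         ∣n⇒∣m*n; ∣m⇒∣m*n; ∣m+n∣n⇒∣m; *-monoˡ-∣; *-cancelˡ-∣)
open import Data.Integer.Properties
  using (_≟_; *-cancelˡ-≡; ∣i∣≡0⇒i≡0; i-j≡0⇒i≡j; i*j≡0⇒i≡0∨j≡0; +-inverseʳ; +-identityˡ; *-comm; pos-+; pos-*)
open import Data.Integer.Tactic.RingSolver using (solve-∀)
open import Data.List using ([]; _∷_)
open import Data.Nat as ℕ using (suc; _≤_; _<_; >-nonZero⁻¹; _≤′_; ≤′-refl; ≤′-step; z≤n; s≤s)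
open import Data.Nat.Divisibility using (∣⇒≤) renaming (_∣_ to _∣ℕ_)
open import Data.Nat.Properties as ℕ
  using (≤-refl; ≤-trans; n≤1+n; n≮n; m≤n+m; m≤m*n; m<n+m; +-monoʳ-<; +-monoˡ-≤; *-monoʳ-≤; ≤⇒≤′; m*n≢0)
open import Data.Product using (_,_; proj₁; proj₂)
open import Data.Sum using (inj₂)
open import Function.Base using (_∘_)
open import Function.Bundles using (Equivalence)
open import Relation.Nullary.Decidable using (⌊_⌋; yes; no; toWitness; fromWitness)
open import Relation.Binary.PropositionalEquality using (refl; sym; trans; cong; cong₂; subst; module ≡-Reasoning)

infix 4 _≡_mod_

_≡_mod_ : ℤ → ℤ → ℤ → Set
_≡_mod_ x y d = d ∣ x - y

≡-mod-refl : ∀ {d} x → x ≡ x mod d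
≡-mod-refl x = divides 0ℤ (+-inverseʳ x)

≡-mod-sym : ∀ {d x y} → x ≡ y mod d → y ≡ x mod d
≡-mod-sym {d} {x} {y} x≡y = subst (d ∣_) (minus-swap x y) (∣m⇒∣-m x≡y)
  where
  minus-swap : ∀ x y → - (x - y) ≡ y - x
  minus-swap = solve-∀

≡0-mod-all⇒≡0 : ∀ {z} → (∀ n .{{_ : ℕ.NonZero n}} → + n ∣ z) → z ≡ 0ℤ
≡0-mod-all⇒≡0 {z} n∣z = ∣i∣≡0⇒i≡0 (suc∣⇒≡0 (∣⇒∣ᵤ (n∣z (suc ∣ z ∣))))
  where
  suc∣⇒≡0 : ∀ {m} → suc m ∣ℕ m → m ≡ 0
  suc∣⇒≡0 {ℕ.zero}  _  = refl
  suc∣⇒≡0 {suc m} sm∣m = ⊥-elim (n≮n (suc m) (∣⇒≤ sm∣m))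

≡-mod-all⇒≡ : ∀ {x y} → (∀ n .{{_ : ℕ.NonZero n}} → x ≡ y mod + n) → x ≡ y
≡-mod-all⇒≡ {x} {y} x≡y = i-j≡0⇒i≡j x y (≡0-mod-all⇒≡0 x≡y)

%ℕ-≡⇒≡-mod : ∀ x y n .{{_ : ℕ.NonZero n}} → x %ℕ n ≡ y %ℕ n → x ≡ y mod + n
%ℕ-≡⇒≡-mod x y n x%n≡y%n = divides (x /ℕ n - y /ℕ n) (begin
  x - y
    ≡⟨ cong₂ _-_ (a≡a%ℕn+[a/ℕn]*n x n) (a≡a%ℕn+[a/ℕn]*n y n) ⟩
  (+ (x %ℕ n) + x /ℕ n * + n) - (+ (y %ℕ n) + y /ℕ n * + n)
    ≡⟨ cong (λ r → (+ (x %ℕ n) + x /ℕ n * + n) - (+ r + y /ℕ n * + n)) (sym x%n≡y%n) ⟩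
  (+ (x %ℕ n) + x /ℕ n * + n) - (+ (x %ℕ n) + y /ℕ n * + n)
    ≡⟨ cancel-remainder (+ (x %ℕ n)) (x /ℕ n) (y /ℕ n) (+ n) ⟩
  (x /ℕ n - y /ℕ n) * + n ∎)
  where
  open ≡-Reasoning
  cancel-remainder : ∀ r q q′ n → (r + q * n) - (r + q′ * n) ≡ (q - q′) * n
  cancel-remainder = solve-∀

eval-cong : ∀ P {d x y} → x ≡ y mod d → eval P x ≡ eval P y mod d
eval-cong []       _   = ≡-mod-refl 0ℤ
eval-cong (c ∷ cs) {d} {x} {y} x≡y =
  subst (d ∣_) (horner-step c x y (eval cs x) (eval cs y))
    (∣m∣n⇒∣m+n (∣n⇒∣m*n x (eval-cong cs x≡y)) (∣m⇒∣m*n (eval cs y) x≡y))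
  where
  horner-step : ∀ c x y u v → x * (u - v) + (x - y) * v ≡ (c + x * u) - (c + y * v)
  horner-step = solve-∀

eval-subConst : ∀ P m x → eval (subConst P m) x ≡ eval P x - m
eval-subConst []       m x = constant m x
  where
  constant : ∀ m x → - m + x * 0ℤ ≡ 0ℤ - m
  constant = solve-∀
eval-subConst (c ∷ cs) m x = shift c m (x * eval cs x)
  where
  shift : ∀ c m u → (c - m) + u ≡ (c + u) - m
  shift = solve-∀

coeff-subConst-suc : ∀ P m i → coeff (subConst P m) (suc i) ≡ coeff P (suc i)
coeff-subConst-suc []       m i = refl
coeff-subConst-suc (c ∷ cs) m i = refl

vanishing⇒coeff≡0 : ∀ P → (∀ t → eval P (+ suc t) ≡ 0ℤ) → ∀ i → coeff P i ≡ 0ℤ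
vanishing⇒coeff≡0 []       _      _ = refl
vanishing⇒coeff≡0 (c ∷ cs) P[t]≡0   = λ { ℕ.zero → c≡0 ; (suc i) → vanishing⇒coeff≡0 cs cs[t]≡0 i }
  where
  n∣c : ∀ n .{{_ : ℕ.NonZero n}} → + n ∣ c
  n∣c (suc t) = ∣m+n∣n⇒∣m (subst (+ suc t ∣_) (sym (P[t]≡0 t)) (≡-mod-refl 0ℤ)) (∣m⇒∣m*n _ ∣-refl)

  c≡0 : c ≡ 0ℤ
  c≡0 = ≡0-mod-all⇒≡0 n∣c

  cs[t]≡0 : ∀ t → eval cs (+ suc t) ≡ 0ℤ
  cs[t]≡0 t with i*j≡0⇒i≡0∨j≡0 (+ suc t)
                   (trans (sym (+-identityˡ _)) (subst (λ c → c + _ ≡ 0ℤ) c≡0 (P[t]≡0 t)))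
  ... | inj₂ cs[t]≡0 = cs[t]≡0

constant⇒coeff-suc≡0 : ∀ P → (∀ t → eval P (+ t) ≡ eval P 0ℤ) → ∀ i → coeff P (suc i) ≡ 0ℤ
constant⇒coeff-suc≡0 P P[t]≡P[0] i = begin
  coeff P (suc i)                        ≡⟨ coeff-subConst-suc P (eval P 0ℤ) i ⟨
  coeff (subConst P (eval P 0ℤ)) (suc i) ≡⟨ vanishing⇒coeff≡0 (subConst P (eval P 0ℤ)) vanishes (suc i) ⟩
  0ℤ                                     ∎
  where
  open ≡-Reasoning
  vanishes : ∀ t → eval (subConst P (eval P 0ℤ)) (+ suc t) ≡ 0ℤ
  vanishes t = trans (eval-subConst P _ _)
                 (trans (cong (_- eval P 0ℤ) (P[t]≡P[0] (suc t))) (+-inverseʳ (eval P 0ℤ)))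

sumFin-cong-mod : ∀ s (a p : Fin s → ℤ) {d c} → (∀ i → p i ≡ c mod d) →
  sumFin s (λ i → a i * p i) ≡ sumFin s a * c mod d
sumFin-cong-mod ℕ.zero  a p _   = ≡-mod-refl 0ℤ
sumFin-cong-mod (suc s) a p {d} {c} p≡c =
  subst (d ∣_) (split (a zero) (p zero) c (sumFin s (λ i → a (suc i) * p (suc i))) (sumFin s (λ i → a (suc i))))
    (∣m∣n⇒∣m+n (∣n⇒∣m*n (a zero) (p≡c zero))
               (sumFin-cong-mod s (λ i → a (suc i)) (λ i → p (suc i)) (λ i → p≡c (suc i))))
  where
  split : ∀ a₀ p₀ c S S′ → a₀ * (p₀ - c) + (S - S′ * c) ≡ (a₀ * p₀ + S) - (a₀ + S′) * c
  split = solve-∀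

solution-mod : ∀ {s a b x d} P t → IsSolution s P a b x → (∀ i → + x i ≡ t mod d) →
  b ≡ sumFin s a * eval P t mod d
solution-mod {s} {a} {x = x} {d} P t (_ , ΣaP[x]≡b) x≡t =
  subst (λ z → z ≡ sumFin s a * eval P t mod d) ΣaP[x]≡b
    (sumFin-cong-mod s a (λ i → eval P (+ x i)) (λ i → eval-cong P (x≡t i)))

residue : (n : ℕ) .{{_ : ℕ.NonZero n}} → ℕ → Fin n
residue n x = fromℕ< (n%ℕd<d (+ x) n)

residue-≡⇒≡-mod : ∀ n .{{_ : ℕ.NonZero n}} {x y} → residue n x ≡ residue n y → + x ≡ + y mod + n
residue-≡⇒≡-mod n {x} {y} eq = %ℕ-≡⇒≡-mod (+ x) (+ y) n (fromℕ<-injective _ _ _ _ eq)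

partitionRegular⇒residues : ∀ {s a b} P → PartitionRegular s P a b →
  ∀ n .{{_ : ℕ.NonZero n}} → ∃ λ t → b ≡ sumFin s a * eval P t mod + n
partitionRegular⇒residues P pr n with pr n (residue n)
... | x , sol , (i , _) , monochromatic =
  + x i , solution-mod P (+ x i) sol (λ j → residue-≡⇒≡-mod n (monochromatic j i))

divide-residues : ∀ (f : ℤ → ℤ) A b → (∀ n .{{_ : ℕ.NonZero n}} → ∃ λ t → b ≡ A * f t mod + n) →
  ∃ λ m → b ≡ A * m × (∀ n .{{_ : ℕ.NonZero n}} → ∃ λ t → f t ≡ m mod + n)
divide-residues f A b b≡Af with A ≟ 0ℤ
... | yes refl = f 0ℤ , b≡0 , λ n → 0ℤ , ≡-mod-refl (f 0ℤ)
  where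
  b≡0 : b ≡ 0ℤ
  b≡0 = ≡-mod-all⇒≡ (λ n → proj₂ (b≡Af n))
... | no A≢0 = m , b≡A*m , f≡m
  where
  instance
    A-nonZero : NonZero A
    A-nonZero = ≢-nonZero A≢0

  A*n∣b-Af : ∀ n .{{_ : ℕ.NonZero n}} → ∃ λ t → A * + n ∣ b - A * f t
  A*n∣b-Af n = let instance _ = m*n≢0 ∣ A ∣ n
                   t , b≡Af[t] = b≡Af (∣ A ∣ ℕ.* n)
               in t , ∣-trans (subst (A * + n ∣_) (sym (pos-* ∣ A ∣ n)) (*-monoˡ-∣ (+ n) (m∣∣m∣ {A}))) b≡Af[t]

  A∣b : A ∣ b
  A∣b = let t , A*1∣ = A*n∣b-Af 1
        in ∣m+n∣n⇒∣m (∣-trans (∣m⇒∣m*n (+ 1) ∣-refl) A*1∣) (∣m⇒∣-m (∣m⇒∣m*n (f t) ∣-refl))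

  quotient : ∃ λ m → b ≡ A * m
  quotient with A∣b
  ... | divides m b≡m*A = m , trans b≡m*A (*-comm m A)

  m : ℤ
  m = proj₁ quotient
  b≡A*m : b ≡ A * m
  b≡A*m = proj₂ quotient

  f≡m : ∀ n .{{_ : ℕ.NonZero n}} → ∃ λ t → f t ≡ m mod + n
  f≡m n = let t , A*n∣ = A*n∣b-Af n
          in t , ≡-mod-sym {+ n} {m} (*-cancelˡ-∣ A {+ n} (subst (A * + n ∣_) (factor t) A*n∣))
    where
    distrib : ∀ A m u → A * m - A * u ≡ A * (m - u)
    distrib = solve-∀
    factor : ∀ t → b - A * f t ≡ A * (m - f t)
    factor t = trans (cong (_- A * f t) b≡A*m) (distrib A m (f t))

residues⇒intersective : ∀ P m → (∀ n .{{_ : ℕ.NonZero n}} → ∃ λ t → eval P t ≡ m mod + n) →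
  Intersective (subConst P m)
residues⇒intersective P m P≡m (suc n) _ =
  let t , P[t]≡m = P≡m (suc n)
  in t , subst (+ suc n Unsigned.∣_) (sym (eval-subConst P m t)) (∣⇒∣ᵤ P[t]≡m)

count-≤-suc : ∀ A N → count A N ≤ count A (suc N)
count-≤-suc A N with A (suc N)
... | true  = n≤1+n (count A N)
... | false = ≤-refl

count-suc-member : ∀ A {N} → A (suc N) ≡ true → count A (suc N) ≡ suc (count A N)
count-suc-member A {N} A[1+N] with A (suc N)
count-suc-member A refl | true = refl

count-mono : ∀ A {M N} → M ≤ N → count A M ≤ count A N
count-mono A = count-mono′ ∘ ≤⇒≤′
  where
  count-mono′ : ∀ {M N} → M ≤′ N → count A M ≤ count A N
  count-mono′ ≤′-refl           = ≤-refl
  count-mono′ (≤′-step {N} M≤N) = ≤-trans (count-mono′ M≤N) (count-≤-suc A N)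

count-member : ∀ A {M x N} → A x ≡ true → M < x → x ≤ N → suc (count A M) ≤ count A N
count-member A {M} {suc x} {N} A[x] (s≤s M≤x) x≤N = begin
  suc (count A M)   ≤⟨ s≤s (count-mono A M≤x) ⟩
  suc (count A x)   ≡⟨ count-suc-member A A[x] ⟨
  count A (suc x)   ≤⟨ count-mono A x≤N ⟩
  count A N         ∎
  where open ℕ.≤-Reasoning

count-progression : ∀ A t n .{{_ : ℕ.NonZero n}} → (∀ j → A (t ℕ.+ j ℕ.* n) ≡ true) →
  ∀ q → q ≤ count A (t ℕ.+ q ℕ.* n)
count-progression A t n progression⊆A ℕ.zero  = z≤n
count-progression A t n progression⊆A (suc q) =
  ≤-trans (s≤s (count-progression A t n progression⊆A q))
          (count-member A (progression⊆A (suc q)) (+-monoʳ-< t (m<n+m (q ℕ.* n) (>-nonZero⁻¹ n))) ≤-refl)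

progression⇒positiveUpperDensity : ∀ A t n .{{_ : ℕ.NonZero n}} → (∀ j → A (t ℕ.+ j ℕ.* n) ≡ true) →
  PositiveUpperDensity A
progression⇒positiveUpperDensity A t n progression⊆A =
  t ℕ.+ n , ≤-trans (>-nonZero⁻¹ n) (m≤n+m n t) ,
  λ M → t ℕ.+ suc M ℕ.* n , ≤-trans (n≤1+n M) (1+M≤N M) , ≤-trans (s≤s z≤n) (1+M≤N M) , N≤k*count M
  where
  1+M≤N : ∀ M → suc M ≤ t ℕ.+ suc M ℕ.* n
  1+M≤N M = ≤-trans (m≤m*n (suc M) n) (m≤n+m _ t)
  N≤k*count : ∀ M → t ℕ.+ suc M ℕ.* n ≤ (t ℕ.+ n) ℕ.* count A (t ℕ.+ suc M ℕ.* n)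
  N≤k*count M = begin
    t ℕ.+ suc M ℕ.* n               ≤⟨ +-monoˡ-≤ (suc M ℕ.* n) (m≤m*n t (suc M)) ⟩
    t ℕ.* suc M ℕ.+ suc M ℕ.* n     ≡⟨ cong (t ℕ.* suc M ℕ.+_) (ℕ.*-comm (suc M) n) ⟩
    t ℕ.* suc M ℕ.+ n ℕ.* suc M     ≡⟨ ℕ.*-distribʳ-+ (suc M) t n ⟨
    (t ℕ.+ n) ℕ.* suc M             ≤⟨ *-monoʳ-≤ (t ℕ.+ n) (count-progression A t n progression⊆A (suc M)) ⟩
    (t ℕ.+ n) ℕ.* count A (t ℕ.+ suc M ℕ.* n) ∎
    where open ℕ.≤-Reasoning

residueClass : ℕ → ℕ → ℕ → Bool
residueClass n t x = ⌊ + n ∣? + x - + t ⌋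

residueClass-member : ∀ n t {x} → residueClass n t x ≡ true → + x ≡ + t mod + n
residueClass-member n t {x} x∈ = toWitness {a? = + n ∣? + x - + t} (Equivalence.from T-≡ x∈)

residueClass-progression : ∀ n t j → residueClass n t (t ℕ.+ j ℕ.* n) ≡ true
residueClass-progression n t j = Equivalence.to T-≡ (fromWitness (divides (+ j) (begin
  + (t ℕ.+ j ℕ.* n) - + t ≡⟨ cong (_- + t) (trans (pos-+ t (j ℕ.* n)) (cong (_+_ (+ t)) (pos-* j n))) ⟩
  (+ t + + j * + n) - + t  ≡⟨ cancel (+ t) (+ j * + n) ⟩
  + j * + n                ∎)))
  where
  open ≡-Reasoning
  cancel : ∀ u v → (u + v) - u ≡ v
  cancel = solve-∀

densityRegular⇒residues : ∀ {s a b} P → DensityRegular s P a b →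
  ∀ n .{{_ : ℕ.NonZero n}} t → b ≡ sumFin s a * eval P (+ t) mod + n
densityRegular⇒residues P dr n t
  with dr (residueClass n t) (progression⇒positiveUpperDensity _ t n (residueClass-progression n t))
... | x , sol , _ , x∈A = solution-mod P (+ t) sol (λ i → residueClass-member n t (x∈A i))

densityRegular⇒b≡ΣaP : ∀ {s a b} P → DensityRegular s P a b → ∀ t → b ≡ sumFin s a * eval P (+ t)
densityRegular⇒b≡ΣaP P dr t = ≡-mod-all⇒≡ (λ n → densityRegular⇒residues P dr n t)

densityRegular⇒Σa≡0 : ∀ {s a b} P → PositiveDegree P → DensityRegular s P a b → sumFin s a ≡ 0ℤ
densityRegular⇒Σa≡0 {s} {a} P (i , coeff≢0) dr with sumFin s a ≟ 0ℤ
... | yes Σa≡0 = Σa≡0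
... | no  Σa≢0 = ⊥-elim (coeff≢0 (constant⇒coeff-suc≡0 P P[t]≡P[0] i))
  where
  instance
    Σa-nonZero : NonZero (sumFin s a)
    Σa-nonZero = ≢-nonZero Σa≢0
  P[t]≡P[0] : ∀ t → eval P (+ t) ≡ eval P 0ℤ
  P[t]≡P[0] t = *-cancelˡ-≡ (sumFin s a) _ _
    (trans (sym (densityRegular⇒b≡ΣaP P dr t)) (densityRegular⇒b≡ΣaP P dr 0))

proposition2p2 : (s : ℕ) (P : Poly) (a : Fin s → ℤ) (b : ℤ) →
    PositiveDegree P → ((i : Fin s) → a i ≢ 0ℤ) →
    (PartitionRegular s P a b →
      ∃ λ (m : ℤ) → b ≡ sumFin s a * m × Intersective (subConst P m))
    × (DensityRegular s P a b → b ≡ sumFin s a × sumFin s a ≡ 0ℤ)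
proposition2p2 s P a b positiveDegree _ = partitionRegular⇒ , densityRegular⇒
  where
  partitionRegular⇒ : PartitionRegular s P a b →
    ∃ λ m → b ≡ sumFin s a * m × Intersective (subConst P m)
  partitionRegular⇒ pr =
    let m , b≡Σa*m , P≡m = divide-residues (eval P) (sumFin s a) b (partitionRegular⇒residues P pr)
    in m , b≡Σa*m , residues⇒intersective P m P≡m

  densityRegular⇒ : DensityRegular s P a b → b ≡ sumFin s a × sumFin s a ≡ 0ℤ
  densityRegular⇒ dr = b≡Σa , Σa≡0
    where
    Σa≡0 : sumFin s a ≡ 0ℤ
    Σa≡0 = densityRegular⇒Σa≡0 P positiveDegree dr
    b≡Σa : b ≡ sumFin s a
    b≡Σa = trans (densityRegular⇒b≡ΣaP P dr 0) (trans (cong (_* eval P 0ℤ) Σa≡0) (sym Σa≡0))
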